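{- For $0<p<1/2$ consider the branching process with a single process symbol $X$, a single synchronisation state $\bot$, and transitions $X\xrightarrow{p}\langle XX\rangle$ and $X\xrightarrow{1-p}\bot$. Then the ratio $\mathbb E W_X/\mathbb E T_X$ is unbounded as $p\to1/2$.
   Context: The system evolves as a Markov chain on binary trees whose leaves are $X$ or $\bot$, starting from the single-leaf tree $X$: in each step, if the tree has no leaf $X$ it stays unchanged; otherwise every leaf $X$ independently is replaced by $\langle XX\rangle$ with probability $p$ or by $\bot$ with probability $1-p$. For a run $w=w(0)w(1)\cdots$, $T_X(w)$ is the least $i$ such that $w(i)$ has no leaf $X$ ($\infty$ if none), and $W_X(w)=\sum_{i\ge0}(\text{number of leaves }X\text{ in }w(i))$; $\mathbb E$ denotes expectation under the induced probability measure on runs. -}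

module Defs where

open import Data.Bool using (Bool; true; false; _∨_; if_then_else_)
open import Data.Nat as ℕ using (ℕ; zero; suc)
open import Data.Integer using (+_)
open import Data.List using (List; []; _∷_; _++_; [_]; map; concatMap; foldr)
open import Data.Product using (_×_; _,_)
open import Data.Rational using (ℚ; _+_; _*_; _-_; 0ℚ; 1ℚ; _/_)

data Tree : Set where
  leafX   : Tree
  leaf⊥   : Tree
  node    : Tree → Tree → Tree

hasX : Tree → Bool
hasX leafX      = true
hasX leaf⊥      = false
hasX (node l r) = hasX l ∨ hasX r

countX : Tree → ℕ
countX leafX      = 1
countX leaf⊥      = 0
countX (node l r) = countX l ℕ.+ countX r

Dist : Set → Set
Dist A = List (A × ℚ)

return : {A : Set} → A → Dist A
return a = [ (a , 1ℚ) ]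

bind : {A B : Set} → Dist A → (A → Dist B) → Dist B
bind d f = concatMap (λ { (a , q) → map (λ { (b , r) → (b , q * r) }) (f a) }) d

replaceLeaves : ℚ → Tree → Dist Tree
replaceLeaves p leafX      = (node leafX leafX , p) ∷ (leaf⊥ , 1ℚ - p) ∷ []
replaceLeaves p leaf⊥      = return leaf⊥
replaceLeaves p (node l r) =
  bind (replaceLeaves p l) λ l' → bind (replaceLeaves p r) λ r' → return (node l' r')

step : ℚ → Tree → Dist Tree
step p t = if hasX t then replaceLeaves p t else return t

-- Distribution of the run prefix w(0) w(1) ... w(n) (chronological list),
-- paired with the current tree w(n); the chain starts from the tree X.
prefixDist : ℚ → ℕ → Dist (List Tree × Tree)
prefixDist p zero    = return ([ leafX ] , leafX)
prefixDist p (suc n) =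
  bind (prefixDist p n) λ { (ws , t) → bind (step p t) λ t' → return (ws ++ [ t' ] , t') }

expect : {A : Set} → Dist A → (A → ℕ) → ℚ
expect d f = foldr (λ { (a , q) acc → q * ((+ f a) / 1) + acc }) 0ℚ d

-- On a prefix w(0)…w(N-1):  min(T_X, N)  where T_X = least i with no leaf X in w(i).
truncT : List Tree → ℕ
truncT []       = 0
truncT (t ∷ ts) = if hasX t then suc (truncT ts) else 0

truncW : List Tree → ℕ
truncW []       = 0
truncW (t ∷ ts) = countX t ℕ.+ truncW ts

-- E[min(T_X, n+1)] and E[Σ_{i≤n} #X(w(i))]; by monotone convergence
-- E T_X and E W_X are the suprema over n of these.
ETtrunc : ℚ → ℕ → ℚ
ETtrunc p n = expect (prefixDist p n) (λ { (ws , _) → truncT ws })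

EWtrunc : ℚ → ℕ → ℚ
EWtrunc p n = expect (prefixDist p n) (λ { (ws , _) → truncW ws })

-- Let f(s) = (1 - p) + p·s² be the offspring generating function and q_m = 1 - f^m(0) the
-- probability that w(m) still has a leaf X.  Then E[min(T_X, n+1)] = Σ_{m≤n} q_m, while
-- E[Σ_{i≤n} #X(w(i))] = Σ_{i≤n} (2p)^i because each step multiplies the expected number of
-- leaves X by 2p.  The recursion q_{m+1} = p·q_m·(2 - q_m) gives q_m ≤ 2/(m+2) for p ≤ ½ and
-- the geometric decay q_{m+1} ≤ 2p·q_m, so E T_X ≤ L + q_L/(1 - 2p) for every L.  For
-- p = ½ - 1/(4L²) this is at most 5L, whereas by Bernoulli's inequality the first L² + 1 terms
-- (2p)^i are all at least ½, so E W_X ≥ L²/2; the ratio thus grows like L/10.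

module Submission where

open import Defs
open import Data.Bool using (Bool; true; false; _∧_; _∨_; if_then_else_)
open import Data.Bool.Properties using (∧-comm; ∧-assoc)
open import Data.List using (List; []; _∷_; _++_; [_]; map)
open import Data.Bool.ListAction using (all)
open import Data.List.Relation.Unary.All as All using (All; []; _∷_)
import Data.List.Relation.Unary.All.Properties as All
open import Data.Nat as ℕ using (ℕ; zero; suc; z≤n; s≤s)
import Data.Nat.Properties as ℕ
import Data.Integer as ℤ
import Data.Integer.Properties as ℤ
open import Data.Product using (Σ; _×_; _,_; proj₁; proj₂)
open import Data.Sum using (inj₁; inj₂)
open import Data.Empty using (⊥-elim)
open import Data.Rational
  using (ℚ; mkℚ; ↥_; ↧ₙ_; 0ℚ; 1ℚ; ½; _+_; _*_; _-_; -_; _/_; 1/_; _≤_; _<_; *≤*; *<*; nonNegative; positive)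
open import Data.Rational.Literals using (fromℤ)
open import Data.Rational.Properties
open import Data.Rational.Solver using (module +-*-Solver)
open +-*-Solver
open import Algebra.Bundles using (CommutativeRing)
open import Algebra.Properties.Semiring.Exp (CommutativeRing.semiring +-*-commutativeRing)
  using (_^_; ^-homo-*)
open import Data.Nat.GeneralisedArithmetic using (fold; iterate; iterate-is-fold)
open import Function using (_∘_)
open import Relation.Binary.PropositionalEquality hiding ([_])

private variable
  A : Set

-- Rationals

-- Unlike (+ n) / 1 as used by expect, fromℤ does not normalise, so numerator and denominator compute.
fromℕ : ℕ → ℚ
fromℕ n = fromℤ (ℤ.+ n)

+n/1≡fromℕ : ∀ n → (ℤ.+ n) / 1 ≡ fromℕ n
+n/1≡fromℕ n = ↥p/↧p≡p (fromℕ n)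

fromℕ-+ : ∀ m n → fromℕ (m ℕ.+ n) ≡ fromℕ m + fromℕ n
fromℕ-+ m n = trans (sym (+n/1≡fromℕ (m ℕ.+ n)))
  (/-cong (sym (cong₂ ℤ._+_ (ℤ.*-identityʳ (ℤ.+ m)) (ℤ.*-identityʳ (ℤ.+ n)))) refl)

fromℕ-* : ∀ m n → fromℕ (m ℕ.* n) ≡ fromℕ m * fromℕ n
fromℕ-* m n = trans (sym (+n/1≡fromℕ (m ℕ.* n))) (/-cong (ℤ.pos-* m n) refl)

fromℕ-mono-≤ : ∀ {m n} → m ℕ.≤ n → fromℕ m ≤ fromℕ n
fromℕ-mono-≤ m≤n = *≤* (ℤ.*-monoʳ-≤-nonNeg (ℤ.+ 1) (ℤ.+≤+ m≤n))

fromℕ-nonNeg : ∀ n → 0ℚ ≤ fromℕ n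
fromℕ-nonNeg n = fromℕ-mono-≤ z≤n

≤-by-difference : ∀ {a b} (e : ℚ) → b - a ≡ e → 0ℚ ≤ e → a ≤ b
≤-by-difference {a} {b} e b-a≡e 0≤e =
  subst₂ _≤_ (+-identityˡ a) (solve 2 (λ a b → (b :- a) :+ a := b) refl a b)
    (+-monoˡ-≤ a (subst (0ℚ ≤_) (sym b-a≡e) 0≤e))

<-by-difference : ∀ {a b} (e : ℚ) → b - a ≡ e → 0ℚ < e → a < b
<-by-difference {a} {b} e b-a≡e 0<e =
  subst₂ _<_ (+-identityˡ a) (solve 2 (λ a b → (b :- a) :+ a := b) refl a b)
    (+-monoˡ-< a (subst (0ℚ <_) (sym b-a≡e) 0<e))

0≤-difference : ∀ {a b} → a ≤ b → 0ℚ ≤ b - a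
0≤-difference {a} {b} a≤b = subst (_≤ b - a) (+-inverseʳ a) (+-monoˡ-≤ (- a) a≤b)

0<-difference : ∀ {a b} → a < b → 0ℚ < b - a
0<-difference {a} {b} a<b = subst (_< b - a) (+-inverseʳ a) (+-monoˡ-< (- a) a<b)

*-nonNeg : ∀ {a b} → 0ℚ ≤ a → 0ℚ ≤ b → 0ℚ ≤ a * b
*-nonNeg {a} {b} 0≤a 0≤b =
  nonNegative⁻¹ (a * b) {{nonNeg*nonNeg⇒nonNeg a {{nonNegative 0≤a}} b {{nonNegative 0≤b}}}}

square-nonNeg : ∀ x → 0ℚ ≤ x * x
square-nonNeg x with ≤-total 0ℚ x
... | inj₁ 0≤x = *-nonNeg 0≤x 0≤x
... | inj₂ x≤0 = subst (0ℚ ≤_) (solve 1 (λ x → (:- x) :* (:- x) := x :* x) refl x) (*-nonNeg 0≤-x 0≤-x)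
  where
  0≤-x : 0ℚ ≤ - x
  0≤-x = neg-antimono-≤ x≤0

nonNeg-cancelˡ : ∀ {c z} → 0ℚ < c → 0ℚ ≤ c * z → 0ℚ ≤ z
nonNeg-cancelˡ {c} {z} 0<c 0≤cz =
  *-cancelˡ-≤-pos c {{positive 0<c}} (subst (_≤ c * z) (sym (*-zeroʳ c)) 0≤cz)

+-nonNeg : ∀ {a b} → 0ℚ ≤ a → 0ℚ ≤ b → 0ℚ ≤ a + b
+-nonNeg = +-mono-≤

p≤p+q : ∀ {p q} → 0ℚ ≤ q → p ≤ p + q
p≤p+q {p} 0≤q = subst (_≤ p + _) (+-identityʳ p) (+-monoʳ-≤ p 0≤q)

0≤½ : 0ℚ ≤ ½
0≤½ = ≤ᵇ⇒≤ _

½≤1 : ½ ≤ 1ℚ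
½≤1 = ≤ᵇ⇒≤ _

1≤2 : 1ℚ ≤ fromℕ 2
1≤2 = ≤ᵇ⇒≤ _

1/fromℕ-< : ∀ {δ} → 0ℚ < δ → ∀ n .{{_ : ℕ.NonZero n}} → ↧ₙ δ ℕ.< n → 1/ fromℕ n < δ
1/fromℕ-< {δ@(mkℚ (ℤ.+ 0)    d _)} 0<δ = ⊥-elim (<-irrefl (sym (↥p≡0⇒p≡0 δ refl)) 0<δ)
1/fromℕ-< {δ@(mkℚ ℤ.-[1+ k ] d _)} 0<δ = ⊥-elim (<-asym 0<δ (negative⁻¹ δ))
1/fromℕ-< {mkℚ ℤ.+[1+ k ]  d _} _ (suc n) ↧δ<n =
  *<* (subst₂ ℤ._<_ (ℤ.pos-* 1 (suc d)) (ℤ.pos-* (suc k) (suc n)) (ℤ.+<+ 1*[1+d]<[1+k]*[1+n]))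
  where
  1*[1+d]<[1+k]*[1+n] : 1 ℕ.* suc d ℕ.< suc k ℕ.* suc n
  1*[1+d]<[1+k]*[1+n] = subst (ℕ._< suc k ℕ.* suc n) (sym (ℕ.*-identityˡ (suc d)))
                              (ℕ.<-≤-trans ↧δ<n (ℕ.m≤n*m (suc n) (suc k)))

p≤∣↥p∣ : ∀ p → p ≤ fromℕ ℤ.∣ ↥ p ∣
p≤∣↥p∣ (mkℚ (ℤ.+ k)    d _) = *≤* (ℤ.*-monoˡ-≤-nonNeg (ℤ.+ k) (ℤ.+≤+ (s≤s z≤n)))
p≤∣↥p∣ (mkℚ ℤ.-[1+ k ] d _) = *≤* ℤ.-≤+

-- Finite sums

∑ : ℕ → (ℕ → ℚ) → ℚ
∑ zero    x = 0ℚ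
∑ (suc n) x = ∑ n x + x n

∑-+ : ∀ m n (x : ℕ → ℚ) → ∑ (m ℕ.+ n) x ≡ ∑ m x + ∑ n (λ i → x (m ℕ.+ i))
∑-+ m zero    x = trans (cong (λ k → ∑ k x) (ℕ.+-identityʳ m)) (sym (+-identityʳ (∑ m x)))
∑-+ m (suc n) x = begin
  ∑ (m ℕ.+ suc n) x                                    ≡⟨ cong (λ k → ∑ k x) (ℕ.+-suc m n) ⟩
  ∑ (m ℕ.+ n) x + x (m ℕ.+ n)                          ≡⟨ cong (_+ x (m ℕ.+ n)) (∑-+ m n x) ⟩
  ∑ m x + ∑ n (λ i → x (m ℕ.+ i)) + x (m ℕ.+ n)        ≡⟨ +-assoc (∑ m x) _ _ ⟩
  ∑ m x + ∑ (suc n) (λ i → x (m ℕ.+ i))                ∎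
  where open ≡-Reasoning

∑-cong : ∀ n {x y : ℕ → ℚ} → (∀ i → x i ≡ y i) → ∑ n x ≡ ∑ n y
∑-cong zero    x≗y = refl
∑-cong (suc n) x≗y = cong₂ _+_ (∑-cong n x≗y) (x≗y n)

∑-mono-≤ : ∀ n {x y : ℕ → ℚ} → (∀ i → i ℕ.< n → x i ≤ y i) → ∑ n x ≤ ∑ n y
∑-mono-≤ zero    x≤y = ≤-refl
∑-mono-≤ (suc n) x≤y =
  +-mono-≤ (∑-mono-≤ n (λ i i<n → x≤y i (ℕ.m≤n⇒m≤1+n i<n))) (x≤y n ℕ.≤-refl)

∑-const : ∀ n c → ∑ n (λ _ → c) ≡ fromℕ n * c
∑-const zero    c = sym (*-zeroˡ c)
∑-const (suc n) c = begin
  ∑ n (λ _ → c) + c      ≡⟨ cong (_+ c) (∑-const n c) ⟩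
  fromℕ n * c + c        ≡⟨ solve 2 (λ m c → m :* c :+ c := (con 1ℚ :+ m) :* c) refl (fromℕ n) c ⟩
  (1ℚ + fromℕ n) * c     ≡⟨ cong (_* c) (sym (fromℕ-+ 1 n)) ⟩
  fromℕ (suc n) * c      ∎
  where open ≡-Reasoning

∑-nonNeg : ∀ n {x : ℕ → ℚ} → (∀ i → 0ℚ ≤ x i) → 0ℚ ≤ ∑ n x
∑-nonNeg n {x} 0≤x =
  subst (_≤ ∑ n x) (trans (∑-const n 0ℚ) (*-zeroʳ (fromℕ n))) (∑-mono-≤ n (λ i _ → 0≤x i))

∑-mono-≤-length : ∀ {m n} {x : ℕ → ℚ} → m ℕ.≤ n → (∀ i → 0ℚ ≤ x i) → ∑ m x ≤ ∑ n x
∑-mono-≤-length {m} {n} {x} m≤n 0≤x = begin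
  ∑ m x                                   ≤⟨ p≤p+q (∑-nonNeg (n ℕ.∸ m) (λ i → 0≤x (m ℕ.+ i))) ⟩
  ∑ m x + ∑ (n ℕ.∸ m) (λ i → x (m ℕ.+ i)) ≡⟨ sym (∑-+ m (n ℕ.∸ m) x) ⟩
  ∑ (m ℕ.+ (n ℕ.∸ m)) x                   ≡⟨ cong (λ k → ∑ k x) (ℕ.m+[n∸m]≡n m≤n) ⟩
  ∑ n x                                   ∎
  where open ≤-Reasoning

∑-geometric-tail : ∀ {r C} → 0ℚ ≤ C → C * r + 1ℚ ≤ C → (y : ℕ → ℚ) → (∀ i → 0ℚ ≤ y i) →
                   (∀ i → y (suc i) ≤ r * y i) → ∀ n → ∑ n y ≤ C * y 0
∑-geometric-tail {r} {C} 0≤C Cr+1≤C y 0≤y contracts n =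
  ≤-trans (p≤p+q (*-nonNeg 0≤C (0≤y n))) (invariant n)
  where
  invariant : ∀ n → ∑ n y + C * y n ≤ C * y 0
  invariant zero    = ≤-reflexive (+-identityˡ (C * y 0))
  invariant (suc n) = begin
    ∑ n y + y n + C * y (suc n)
      ≤⟨ +-monoʳ-≤ (∑ n y + y n) (*-monoˡ-≤-nonNeg C {{nonNegative 0≤C}} (contracts n)) ⟩
    ∑ n y + y n + C * (r * y n)
      ≡⟨ solve 4 (λ s c r y → s :+ y :+ c :* (r :* y) := s :+ (c :* r :+ con 1ℚ) :* y) refl (∑ n y) C r (y n) ⟩
    ∑ n y + (C * r + 1ℚ) * y n
      ≤⟨ +-monoʳ-≤ (∑ n y) (*-monoʳ-≤-nonNeg (y n) {{nonNegative (0≤y n)}} Cr+1≤C) ⟩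
    ∑ n y + C * y n
      ≤⟨ invariant n ⟩
    C * y 0 ∎
    where open ≤-Reasoning

bernoulli : ∀ {r} → 0ℚ ≤ r → ∀ i → 1ℚ - fromℕ i * (1ℚ - r) ≤ r ^ i
bernoulli {r} 0≤r zero    = ≤-reflexive (solve 1 (λ r → con 1ℚ :- con 0ℚ :* (con 1ℚ :- r) := con 1ℚ) refl r)
bernoulli {r} 0≤r (suc i) = begin
  1ℚ - fromℕ (suc i) * h   ≡⟨ cong (λ m → 1ℚ - m * h) (fromℕ-+ 1 i) ⟩
  1ℚ - (1ℚ + m) * h        ≤⟨ ≤-by-difference (m * (h * h))
                               (solve 2 (λ r m → let h = con 1ℚ :- r in
                                                   r :* (con 1ℚ :- m :* h) :- (con 1ℚ :- (con 1ℚ :+ m) :* h)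
                                                := m :* (h :* h)) refl r m)
                               (*-nonNeg (fromℕ-nonNeg i) (square-nonNeg h)) ⟩
  r * (1ℚ - m * h)         ≤⟨ *-monoˡ-≤-nonNeg r {{nonNegative 0≤r}} (bernoulli 0≤r i) ⟩
  r * r ^ i                ∎
  where
  open ≤-Reasoning
  m = fromℕ i
  h = 1ℚ - r

½[n+1]≤∑-powers : ∀ {r} → 0ℚ ≤ r → r ≤ 1ℚ → ∀ n → fromℕ n * (1ℚ - r) ≤ ½ →
             ½ * fromℕ (suc n) ≤ ∑ (suc n) (r ^_)
½[n+1]≤∑-powers {r} 0≤r r≤1 n nh≤½ = begin
  ½ * fromℕ (suc n)          ≡⟨ *-comm ½ (fromℕ (suc n)) ⟩
  fromℕ (suc n) * ½          ≡⟨ sym (∑-const (suc n) ½) ⟩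
  ∑ (suc n) (λ _ → ½)        ≤⟨ ∑-mono-≤ (suc n) (λ i i<1+n → ≤-trans (½≤1-ih i (ℕ.≤-pred i<1+n)) (bernoulli 0≤r i))
                              ⟩
  ∑ (suc n) (r ^_)           ∎
  where
  open ≤-Reasoning
  ih≤nh : ∀ {i} → i ℕ.≤ n → fromℕ i * (1ℚ - r) ≤ fromℕ n * (1ℚ - r)
  ih≤nh i≤n = *-monoʳ-≤-nonNeg (1ℚ - r) {{nonNegative (0≤-difference r≤1)}} (fromℕ-mono-≤ i≤n)
  ½≤1-ih : ∀ i → i ℕ.≤ n → ½ ≤ 1ℚ - fromℕ i * (1ℚ - r)
  ½≤1-ih i i≤n = ≤-by-difference (½ - fromℕ i * (1ℚ - r))
    (solve 2 (λ m h → (con 1ℚ :- m :* h) :- con ½ := con ½ :- m :* h) refl (fromℕ i) (1ℚ - r))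
    (0≤-difference (≤-trans (ih≤nh i≤n) nh≤½))

-- Expectation over finite distributions

𝔼 : Dist A → (A → ℚ) → ℚ
𝔼 []            g = 0ℚ
𝔼 ((a , q) ∷ d) g = q * g a + 𝔼 d g

mass : Dist A → ℚ
mass d = 𝔼 d (λ _ → 1ℚ)

AlmostSurely : (A → Set) → Dist A → Set
AlmostSurely P = All (P ∘ proj₁)

𝔼-++ : (d e : Dist A) (g : A → ℚ) → 𝔼 (d ++ e) g ≡ 𝔼 d g + 𝔼 e g
𝔼-++ []            e g = sym (+-identityˡ _)
𝔼-++ ((a , q) ∷ d) e g =
  trans (cong (_+_ (q * g a)) (𝔼-++ d e g)) (sym (+-assoc (q * g a) (𝔼 d g) (𝔼 e g)))

-- h is abstract because bind reweights with a pattern lambda of its own.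
𝔼-reweight : (c : ℚ) (h : A × ℚ → A × ℚ) → (∀ a q → h (a , q) ≡ (a , c * q)) →
             (d : Dist A) (g : A → ℚ) → 𝔼 (map h d) g ≡ c * 𝔼 d g
𝔼-reweight c h h≡ []            g = sym (*-zeroʳ c)
𝔼-reweight c h h≡ ((a , q) ∷ d) g rewrite h≡ a q | 𝔼-reweight c h h≡ d g =
  solve 4 (λ c q x y → (c :* q) :* x :+ c :* y := c :* (q :* x :+ y)) refl c q (g a) (𝔼 d g)

𝔼-bind : ∀ {B : Set} (d : Dist A) (f : A → Dist B) (g : B → ℚ) →
         𝔼 (bind d f) g ≡ 𝔼 d (λ a → 𝔼 (f a) g)
𝔼-bind []            f g = refl
𝔼-bind ((a , q) ∷ d) f g =
  trans (𝔼-++ (map _ (f a)) (bind d f) g)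
        (cong₂ _+_ (𝔼-reweight q _ (λ _ _ → refl) (f a) g) (𝔼-bind d f g))

𝔼-return : (a : A) (g : A → ℚ) → 𝔼 (return a) g ≡ g a
𝔼-return a g = trans (+-identityʳ _) (*-identityˡ _)

𝔼-cong-as : (d : Dist A) {g h : A → ℚ} → AlmostSurely (λ a → g a ≡ h a) d → 𝔼 d g ≡ 𝔼 d h
𝔼-cong-as []            []          = refl
𝔼-cong-as ((a , q) ∷ d) (ga≡ha ∷ e) = cong₂ _+_ (cong (q *_) ga≡ha) (𝔼-cong-as d e)

𝔼-cong : (d : Dist A) {g h : A → ℚ} → (∀ a → g a ≡ h a) → 𝔼 d g ≡ 𝔼 d h
𝔼-cong d g≗h = 𝔼-cong-as d (All.universal (g≗h ∘ proj₁) d)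

𝔼-*ˡ : (d : Dist A) (c : ℚ) (g : A → ℚ) → 𝔼 d (λ a → c * g a) ≡ c * 𝔼 d g
𝔼-*ˡ []            c g = sym (*-zeroʳ c)
𝔼-*ˡ ((a , q) ∷ d) c g rewrite 𝔼-*ˡ d c g =
  solve 4 (λ q c x y → q :* (c :* x) :+ c :* y := c :* (q :* x :+ y)) refl q c (g a) (𝔼 d g)

𝔼-+ : (d : Dist A) (g h : A → ℚ) → 𝔼 d (λ a → g a + h a) ≡ 𝔼 d g + 𝔼 d h
𝔼-+ []            g h = sym (+-identityˡ _)
𝔼-+ ((a , q) ∷ d) g h rewrite 𝔼-+ d g h =
  solve 5 (λ q x y u v → q :* (x :+ y) :+ (u :+ v) := (q :* x :+ u) :+ (q :* y :+ v))
    refl q (g a) (h a) (𝔼 d g) (𝔼 d h)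

𝔼-- : (d : Dist A) (g h : A → ℚ) → 𝔼 d (λ a → g a - h a) ≡ 𝔼 d g - 𝔼 d h
𝔼-- []            g h = refl
𝔼-- ((a , q) ∷ d) g h rewrite 𝔼-- d g h =
  solve 5 (λ q x y u v → q :* (x :- y) :+ (u :- v) := (q :* x :+ u) :- (q :* y :+ v))
    refl q (g a) (h a) (𝔼 d g) (𝔼 d h)

𝔼-const : (d : Dist A) → mass d ≡ 1ℚ → (c : ℚ) → 𝔼 d (λ _ → c) ≡ c
𝔼-const d m≡1 c = begin
  𝔼 d (λ _ → c)        ≡⟨ 𝔼-cong d (λ _ → sym (*-identityʳ c)) ⟩
  𝔼 d (λ _ → c * 1ℚ)   ≡⟨ 𝔼-*ˡ d c (λ _ → 1ℚ) ⟩
  c * mass d           ≡⟨ cong (c *_) m≡1 ⟩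
  c * 1ℚ               ≡⟨ *-identityʳ c ⟩
  c                    ∎
  where open ≡-Reasoning

𝔼-const-+ : (d : Dist A) → mass d ≡ 1ℚ → (c : ℚ) (g : A → ℚ) →
            𝔼 d (λ a → c + g a) ≡ c + 𝔼 d g
𝔼-const-+ d m≡1 c g = trans (𝔼-+ d (λ _ → c) g) (cong (_+ 𝔼 d g) (𝔼-const d m≡1 c))

module _ {B : Set} (d : Dist A) (e : Dist B) where

  𝔼-independent-* : (g : A → ℚ) (h : B → ℚ) →
                    𝔼 d (λ a → 𝔼 e (λ b → g a * h b)) ≡ 𝔼 d g * 𝔼 e h
  𝔼-independent-* g h = begin
    𝔼 d (λ a → 𝔼 e (λ b → g a * h b)) ≡⟨ 𝔼-cong d (λ a → 𝔼-*ˡ e (g a) h) ⟩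
    𝔼 d (λ a → g a * 𝔼 e h)           ≡⟨ 𝔼-cong d (λ a → *-comm (g a) (𝔼 e h)) ⟩
    𝔼 d (λ a → 𝔼 e h * g a)           ≡⟨ 𝔼-*ˡ d (𝔼 e h) g ⟩
    𝔼 e h * 𝔼 d g                     ≡⟨ *-comm (𝔼 e h) (𝔼 d g) ⟩
    𝔼 d g * 𝔼 e h                     ∎
    where open ≡-Reasoning

  𝔼-independent-+ : mass d ≡ 1ℚ → mass e ≡ 1ℚ → (g : A → ℚ) (h : B → ℚ) →
                    𝔼 d (λ a → 𝔼 e (λ b → g a + h b)) ≡ 𝔼 d g + 𝔼 e h
  𝔼-independent-+ md me g h = begin
    𝔼 d (λ a → 𝔼 e (λ b → g a + h b)) ≡⟨ 𝔼-cong d (λ a → 𝔼-const-+ e me (g a) h) ⟩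
    𝔼 d (λ a → g a + 𝔼 e h)           ≡⟨ 𝔼-+ d g (λ _ → 𝔼 e h) ⟩
    𝔼 d g + 𝔼 d (λ _ → 𝔼 e h)         ≡⟨ cong (𝔼 d g +_) (𝔼-const d md (𝔼 e h)) ⟩
    𝔼 d g + 𝔼 e h                     ∎
    where open ≡-Reasoning

almostSurely-bind : ∀ {B : Set} {P : A → Set} {Q : B → Set} (d : Dist A) (f : A → Dist B) →
                    AlmostSurely P d → (∀ a → P a → AlmostSurely Q (f a)) → AlmostSurely Q (bind d f)
almostSurely-bind []            f []         Qf = []
almostSurely-bind ((a , q) ∷ d) f (Pa ∷ Pd) Qf =
  All.++⁺ (All.map⁺ (Qf a Pa)) (almostSurely-bind d f Pd Qf)

expect≡𝔼 : (d : Dist A) (f : A → ℕ) → expect d f ≡ 𝔼 d (fromℕ ∘ f)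
expect≡𝔼 []            f = refl
expect≡𝔼 ((a , q) ∷ d) f = cong₂ _+_ (cong (q *_) (+n/1≡fromℕ (f a))) (expect≡𝔼 d f)

-- The branching chain

0<ᵇ-+ : ∀ m n → (0 ℕ.<ᵇ m) ∨ (0 ℕ.<ᵇ n) ≡ (0 ℕ.<ᵇ m ℕ.+ n)
0<ᵇ-+ zero    n = refl
0<ᵇ-+ (suc m) n = refl

hasX-countX : ∀ t → hasX t ≡ (0 ℕ.<ᵇ countX t)
hasX-countX leafX      = refl
hasX-countX leaf⊥      = refl
hasX-countX (node l r) rewrite hasX-countX l | hasX-countX r = 0<ᵇ-+ (countX l) (countX r)

countX-noX : ∀ t → hasX t ≡ false → countX t ≡ 0
countX-noX t noX = n≡0 (countX t) (trans (sym (hasX-countX t)) noX)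
  where
  n≡0 : ∀ n → (0 ℕ.<ᵇ n) ≡ false → n ≡ 0
  n≡0 zero    _ = refl
  n≡0 (suc n) ()

𝟙 : Bool → ℕ
𝟙 b = if b then 1 else 0

fromℕ-𝟙-<ᵇ : ∀ n → fromℕ (𝟙 (0 ℕ.<ᵇ n)) ≡ 1ℚ - 0ℚ ^ n
fromℕ-𝟙-<ᵇ zero    = refl
fromℕ-𝟙-<ᵇ (suc n) = sym (cong (_-_ 1ℚ) (*-zeroˡ (0ℚ ^ n)))

all-snoc : ∀ ws t → all hasX (ws ++ [ t ]) ≡ all hasX ws ∧ hasX t
all-snoc []       t = ∧-comm (hasX t) true
all-snoc (u ∷ ws) t =
  trans (cong (hasX u ∧_) (all-snoc ws t)) (sym (∧-assoc (hasX u) (all hasX ws) (hasX t)))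

truncW-snoc : ∀ ws t → truncW (ws ++ [ t ]) ≡ truncW ws ℕ.+ countX t
truncW-snoc []       t = ℕ.+-identityʳ (countX t)
truncW-snoc (u ∷ ws) t =
  trans (cong (countX u ℕ.+_) (truncW-snoc ws t)) (sym (ℕ.+-assoc (countX u) (truncW ws) (countX t)))

truncT-snoc : ∀ ws t → truncT (ws ++ [ t ]) ≡ truncT ws ℕ.+ 𝟙 (all hasX ws ∧ hasX t)
truncT-snoc []       t with hasX t
... | true  = refl
... | false = refl
truncT-snoc (u ∷ ws) t with hasX u
... | true  = cong suc (truncT-snoc ws t)
... | false = refl

-- X-free trees are absorbing, so every reachable pair (run prefix, current tree) is coherent;
-- on coherent pairs truncT grows by one exactly when the new tree still has a leaf X.
Coherent : List Tree × Tree → Set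
Coherent (ws , t) = all hasX ws ≡ hasX t

offspringPGF : ℚ → ℚ → ℚ
offspringPGF p s = (1ℚ - p) + p * (s * s)

survival : ℚ → ℕ → ℚ
survival p m = 1ℚ - iterate (offspringPGF p) 0ℚ m

module _ (p : ℚ) where

  replaceLeaves-node : ∀ l r (g : Tree → ℚ) →
    𝔼 (replaceLeaves p (node l r)) g ≡
    𝔼 (replaceLeaves p l) (λ l' → 𝔼 (replaceLeaves p r) (λ r' → g (node l' r')))
  replaceLeaves-node l r g =
    trans (𝔼-bind (replaceLeaves p l) _ g) (𝔼-cong (replaceLeaves p l) λ l' →
      trans (𝔼-bind (replaceLeaves p r) (λ r' → return (node l' r')) g)
            (𝔼-cong (replaceLeaves p r) λ r' → 𝔼-return (node l' r') g))

  replaceLeaves-mass : ∀ t → mass (replaceLeaves p t) ≡ 1ℚ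
  replaceLeaves-mass leafX      =
    solve 1 (λ p → p :* con 1ℚ :+ ((con 1ℚ :- p) :* con 1ℚ :+ con 0ℚ) := con 1ℚ) refl p
  replaceLeaves-mass leaf⊥      = 𝔼-return leaf⊥ (λ _ → 1ℚ)
  replaceLeaves-mass (node l r) =
    trans (replaceLeaves-node l r (λ _ → 1ℚ))
          (trans (𝔼-const (replaceLeaves p l) (replaceLeaves-mass l) (mass (replaceLeaves p r)))
                 (replaceLeaves-mass r))

  replaceLeaves-pgf : ∀ t s → 𝔼 (replaceLeaves p t) (λ t' → s ^ countX t') ≡ offspringPGF p s ^ countX t
  replaceLeaves-pgf leafX      s =
    solve 2 (λ p s → p :* (s :* (s :* con 1ℚ)) :+ ((con 1ℚ :- p) :* con 1ℚ :+ con 0ℚ)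
                   := ((con 1ℚ :- p) :+ p :* (s :* s)) :* con 1ℚ) refl p s
  replaceLeaves-pgf leaf⊥      s = 𝔼-return leaf⊥ (λ t' → s ^ countX t')
  replaceLeaves-pgf (node l r) s = begin
    𝔼 (replaceLeaves p (node l r)) (λ t' → s ^ countX t')
      ≡⟨ replaceLeaves-node l r _ ⟩
    𝔼 (replaceLeaves p l) (λ l' → 𝔼 (replaceLeaves p r) (λ r' → s ^ (countX l' ℕ.+ countX r')))
      ≡⟨ 𝔼-cong (replaceLeaves p l) (λ l' →
           𝔼-cong (replaceLeaves p r) (λ r' → ^-homo-* s (countX l') (countX r'))) ⟩
    𝔼 (replaceLeaves p l) (λ l' → 𝔼 (replaceLeaves p r) (λ r' → s ^ countX l' * s ^ countX r'))
      ≡⟨ 𝔼-independent-* (replaceLeaves p l) (replaceLeaves p r) (λ l' → s ^ countX l') (λ r' → s ^ countX r')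
       ⟩
    𝔼 (replaceLeaves p l) (λ l' → s ^ countX l') * 𝔼 (replaceLeaves p r) (λ r' → s ^ countX r')
      ≡⟨ cong₂ _*_ (replaceLeaves-pgf l s) (replaceLeaves-pgf r s) ⟩
    offspringPGF p s ^ countX l * offspringPGF p s ^ countX r
      ≡⟨ sym (^-homo-* (offspringPGF p s) (countX l) (countX r)) ⟩
    offspringPGF p s ^ countX (node l r) ∎
    where open ≡-Reasoning

  replaceLeaves-mean : ∀ t → 𝔼 (replaceLeaves p t) (fromℕ ∘ countX) ≡ (p + p) * fromℕ (countX t)
  replaceLeaves-mean leafX      =
    solve 1 (λ p → p :* (con 1ℚ :+ con 1ℚ) :+ ((con 1ℚ :- p) :* con 0ℚ :+ con 0ℚ) := (p :+ p) :* con 1ℚ)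
      refl p
  replaceLeaves-mean leaf⊥      = trans (𝔼-return leaf⊥ (fromℕ ∘ countX)) (sym (*-zeroʳ (p + p)))
  replaceLeaves-mean (node l r) = begin
    𝔼 (replaceLeaves p (node l r)) (fromℕ ∘ countX)
      ≡⟨ replaceLeaves-node l r _ ⟩
    𝔼 (replaceLeaves p l) (λ l' → 𝔼 (replaceLeaves p r) (λ r' → fromℕ (countX l' ℕ.+ countX r')))
      ≡⟨ 𝔼-cong (replaceLeaves p l) (λ l' →
           𝔼-cong (replaceLeaves p r) (λ r' → fromℕ-+ (countX l') (countX r'))) ⟩
    𝔼 (replaceLeaves p l) (λ l' → 𝔼 (replaceLeaves p r) (λ r' → fromℕ (countX l') + fromℕ (countX r')))
      ≡⟨ 𝔼-independent-+ (replaceLeaves p l) (replaceLeaves p r) (replaceLeaves-mass l) (replaceLeaves-mass r)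
                         (fromℕ ∘ countX) (fromℕ ∘ countX) ⟩
    𝔼 (replaceLeaves p l) (fromℕ ∘ countX) + 𝔼 (replaceLeaves p r) (fromℕ ∘ countX)
      ≡⟨ cong₂ _+_ (replaceLeaves-mean l) (replaceLeaves-mean r) ⟩
    (p + p) * fromℕ (countX l) + (p + p) * fromℕ (countX r)
      ≡⟨ sym (*-distribˡ-+ (p + p) (fromℕ (countX l)) (fromℕ (countX r))) ⟩
    (p + p) * (fromℕ (countX l) + fromℕ (countX r))
      ≡⟨ cong ((p + p) *_) (sym (fromℕ-+ (countX l) (countX r))) ⟩
    (p + p) * fromℕ (countX (node l r)) ∎
    where open ≡-Reasoning

  step-countX : {g h : ℕ → ℚ} → g 0 ≡ h 0 →
    (∀ t → 𝔼 (replaceLeaves p t) (g ∘ countX) ≡ h (countX t)) →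
    ∀ t → 𝔼 (step p t) (g ∘ countX) ≡ h (countX t)
  step-countX {g} {h} g0≡h0 replaceLeaves-law t with hasX t in noX
  ... | true  = replaceLeaves-law t
  ... | false =
    trans (𝔼-return t (g ∘ countX)) (subst (λ n → g n ≡ h n) (sym (countX-noX t noX)) g0≡h0)

  step-mass : ∀ t → mass (step p t) ≡ 1ℚ
  step-mass = step-countX {λ _ → 1ℚ} {λ _ → 1ℚ} refl replaceLeaves-mass

  step-hasX : ∀ t → AlmostSurely (λ t' → hasX t ∧ hasX t' ≡ hasX t') (step p t)
  step-hasX t with hasX t in noX
  ... | true  = All.universal (λ _ → refl) _
  ... | false = sym noX ∷ []

  prefixDist-zero : (G : List Tree × Tree → ℚ) → 𝔼 (prefixDist p 0) G ≡ G ([ leafX ] , leafX)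
  prefixDist-zero = 𝔼-return ([ leafX ] , leafX)

  prefixDist-suc : ∀ n (G : List Tree × Tree → ℚ) →
    𝔼 (prefixDist p (suc n)) G ≡
    𝔼 (prefixDist p n) (λ x → 𝔼 (step p (proj₂ x)) (λ t' → G (proj₁ x ++ [ t' ] , t')))
  prefixDist-suc n G = trans (𝔼-bind (prefixDist p n) _ G) (𝔼-cong (prefixDist p n) λ x →
    trans (𝔼-bind (step p (proj₂ x)) (λ t' → return (proj₁ x ++ [ t' ] , t')) G)
          (𝔼-cong (step p (proj₂ x)) (λ t' → 𝔼-return (proj₁ x ++ [ t' ] , t') G)))

  prefixDist-countX : ∀ n {g h : ℕ → ℚ} → g 0 ≡ h 0 →
    (∀ t → 𝔼 (replaceLeaves p t) (g ∘ countX) ≡ h (countX t)) →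
    𝔼 (prefixDist p (suc n)) (g ∘ countX ∘ proj₂) ≡ 𝔼 (prefixDist p n) (h ∘ countX ∘ proj₂)
  prefixDist-countX n {g} {h} g0≡h0 replaceLeaves-law =
    trans (prefixDist-suc n (g ∘ countX ∘ proj₂))
          (𝔼-cong (prefixDist p n) (step-countX {g} {h} g0≡h0 replaceLeaves-law ∘ proj₂))

  prefixDist-mass : ∀ n → mass (prefixDist p n) ≡ 1ℚ
  prefixDist-mass zero    = prefixDist-zero (λ _ → 1ℚ)
  prefixDist-mass (suc n) =
    trans (prefixDist-countX n {λ _ → 1ℚ} {λ _ → 1ℚ} refl replaceLeaves-mass) (prefixDist-mass n)

  prefixDist-pgf : ∀ n s → 𝔼 (prefixDist p n) (λ x → s ^ countX (proj₂ x)) ≡ iterate (offspringPGF p) s n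
  prefixDist-pgf zero    s = trans (prefixDist-zero (λ x → s ^ countX (proj₂ x))) (*-identityʳ s)
  prefixDist-pgf (suc n) s =
    trans (prefixDist-countX n {s ^_} {offspringPGF p s ^_} refl (λ t → replaceLeaves-pgf t s))
          (prefixDist-pgf n (offspringPGF p s))

  prefixDist-mean : ∀ n → 𝔼 (prefixDist p n) (fromℕ ∘ countX ∘ proj₂) ≡ (p + p) ^ n
  prefixDist-mean zero    = prefixDist-zero (fromℕ ∘ countX ∘ proj₂)
  prefixDist-mean (suc n) = begin
    𝔼 (prefixDist p (suc n)) (fromℕ ∘ countX ∘ proj₂)
      ≡⟨ prefixDist-countX n {fromℕ} {λ k → (p + p) * fromℕ k} (sym (*-zeroʳ (p + p))) replaceLeaves-mean ⟩
    𝔼 (prefixDist p n) (λ x → (p + p) * fromℕ (countX (proj₂ x)))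
      ≡⟨ 𝔼-*ˡ (prefixDist p n) (p + p) (fromℕ ∘ countX ∘ proj₂) ⟩
    (p + p) * 𝔼 (prefixDist p n) (fromℕ ∘ countX ∘ proj₂)
      ≡⟨ cong ((p + p) *_) (prefixDist-mean n) ⟩
    (p + p) ^ suc n ∎
    where open ≡-Reasoning

  step-coherent : ∀ ws t → Coherent (ws , t) →
    AlmostSurely (λ t' → all hasX ws ∧ hasX t' ≡ hasX t') (step p t)
  step-coherent ws t coherent =
    All.map (λ {(t' , _)} t∧t'≡t' → trans (cong (_∧ hasX t') coherent) t∧t'≡t') (step-hasX t)

  prefixDist-coherent : ∀ n → AlmostSurely Coherent (prefixDist p n)
  prefixDist-coherent zero    = refl ∷ []
  prefixDist-coherent (suc n) =
    almostSurely-bind (prefixDist p n) _ (prefixDist-coherent n) λ { (ws , t) coherent →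
      almostSurely-bind (step p t) _ (step-coherent ws t coherent) λ t' ws∧t'≡t' →
        trans (all-snoc ws t') ws∧t'≡t' ∷ [] }

  prefixDist-additive : (G : List Tree → ℚ) (g : Tree → ℚ) → G [ leafX ] ≡ g leafX →
    (∀ ws t → Coherent (ws , t) → AlmostSurely (λ t' → G (ws ++ [ t' ]) ≡ G ws + g t') (step p t)) →
    ∀ n → 𝔼 (prefixDist p n) (G ∘ proj₁) ≡ ∑ (suc n) (λ m → 𝔼 (prefixDist p m) (g ∘ proj₂))
  prefixDist-additive G g G₀ G-snoc zero =
    trans (prefixDist-zero (G ∘ proj₁)) (trans G₀ (sym (trans (+-identityˡ _) (prefixDist-zero (g ∘ proj₂)))))
  prefixDist-additive G g G₀ G-snoc (suc n) = begin
    𝔼 (prefixDist p (suc n)) (G ∘ proj₁)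
      ≡⟨ prefixDist-suc n (G ∘ proj₁) ⟩
    𝔼 (prefixDist p n) (λ x → 𝔼 (step p (proj₂ x)) (λ t' → G (proj₁ x ++ [ t' ])))
      ≡⟨ 𝔼-cong-as (prefixDist p n) (All.map (λ {(x , _)} → one-step x) (prefixDist-coherent n)) ⟩
    𝔼 (prefixDist p n) (λ x → G (proj₁ x) + 𝔼 (step p (proj₂ x)) g)
      ≡⟨ 𝔼-+ (prefixDist p n) (G ∘ proj₁) (λ x → 𝔼 (step p (proj₂ x)) g) ⟩
    𝔼 (prefixDist p n) (G ∘ proj₁) + 𝔼 (prefixDist p n) (λ x → 𝔼 (step p (proj₂ x)) g)
      ≡⟨ cong₂ _+_ (prefixDist-additive G g G₀ G-snoc n) (sym (prefixDist-suc n (g ∘ proj₂))) ⟩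
    ∑ (suc (suc n)) (λ m → 𝔼 (prefixDist p m) (g ∘ proj₂)) ∎
    where
    open ≡-Reasoning
    one-step : ∀ x → Coherent x →
      𝔼 (step p (proj₂ x)) (λ t' → G (proj₁ x ++ [ t' ])) ≡ G (proj₁ x) + 𝔼 (step p (proj₂ x)) g
    one-step (ws , t) coherent =
      trans (𝔼-cong-as (step p t) (G-snoc ws t coherent)) (𝔼-const-+ (step p t) (step-mass t) (G ws) g)

  prefixDist-hasX : ∀ m → 𝔼 (prefixDist p m) (fromℕ ∘ 𝟙 ∘ hasX ∘ proj₂) ≡ survival p m
  prefixDist-hasX m = begin
    𝔼 (prefixDist p m) (fromℕ ∘ 𝟙 ∘ hasX ∘ proj₂)
      ≡⟨ 𝔼-cong (prefixDist p m) (λ x →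
           trans (cong (fromℕ ∘ 𝟙) (hasX-countX (proj₂ x))) (fromℕ-𝟙-<ᵇ (countX (proj₂ x)))) ⟩
    𝔼 (prefixDist p m) (λ x → 1ℚ - 0ℚ ^ countX (proj₂ x))
      ≡⟨ 𝔼-- (prefixDist p m) (λ _ → 1ℚ) (λ x → 0ℚ ^ countX (proj₂ x)) ⟩
    mass (prefixDist p m) - 𝔼 (prefixDist p m) (λ x → 0ℚ ^ countX (proj₂ x))
      ≡⟨ cong₂ _-_ (prefixDist-mass m) (prefixDist-pgf m 0ℚ) ⟩
    survival p m ∎
    where open ≡-Reasoning

  ETtrunc≡∑survival : ∀ n → ETtrunc p n ≡ ∑ (suc n) (survival p)
  ETtrunc≡∑survival n = begin
    ETtrunc p n
      ≡⟨ trans (expect≡𝔼 (prefixDist p n) _) (𝔼-cong (prefixDist p n) λ { (ws , t) → refl }) ⟩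
    𝔼 (prefixDist p n) (fromℕ ∘ truncT ∘ proj₁)
      ≡⟨ prefixDist-additive (fromℕ ∘ truncT) (fromℕ ∘ 𝟙 ∘ hasX) refl truncT-growth n ⟩
    ∑ (suc n) (λ m → 𝔼 (prefixDist p m) (fromℕ ∘ 𝟙 ∘ hasX ∘ proj₂))
      ≡⟨ ∑-cong (suc n) prefixDist-hasX ⟩
    ∑ (suc n) (survival p) ∎
    where
    open ≡-Reasoning
    truncT-growth : ∀ ws t → Coherent (ws , t) →
      AlmostSurely (λ t' → fromℕ (truncT (ws ++ [ t' ])) ≡ fromℕ (truncT ws) + fromℕ (𝟙 (hasX t'))) (step p t)
    truncT-growth ws t coherent = All.map (λ {(t' , _)} ws∧t'≡t' →
      trans (cong fromℕ (trans (truncT-snoc ws t') (cong (λ b → truncT ws ℕ.+ 𝟙 b) ws∧t'≡t')))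
            (fromℕ-+ (truncT ws) (𝟙 (hasX t'))))
      (step-coherent ws t coherent)

  EWtrunc≡∑mean : ∀ n → EWtrunc p n ≡ ∑ (suc n) ((p + p) ^_)
  EWtrunc≡∑mean n = begin
    EWtrunc p n
      ≡⟨ trans (expect≡𝔼 (prefixDist p n) _) (𝔼-cong (prefixDist p n) λ { (ws , t) → refl }) ⟩
    𝔼 (prefixDist p n) (fromℕ ∘ truncW ∘ proj₁)
      ≡⟨ prefixDist-additive (fromℕ ∘ truncW) (fromℕ ∘ countX) refl truncW-growth n ⟩
    ∑ (suc n) (λ m → 𝔼 (prefixDist p m) (fromℕ ∘ countX ∘ proj₂))
      ≡⟨ ∑-cong (suc n) prefixDist-mean ⟩
    ∑ (suc n) ((p + p) ^_) ∎
    where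
    open ≡-Reasoning
    truncW-growth : ∀ ws t → Coherent (ws , t) →
      AlmostSurely (λ t' → fromℕ (truncW (ws ++ [ t' ])) ≡ fromℕ (truncW ws) + fromℕ (countX t')) (step p t)
    truncW-growth ws t _ = All.universal (λ { (t' , _) →
      trans (cong fromℕ (truncW-snoc ws t')) (fromℕ-+ (truncW ws) (countX t')) }) (step p t)

-- Survival probabilities

survival-suc : ∀ p m → survival p (suc m) ≡ p * (survival p m * (fromℕ 2 - survival p m))
survival-suc p m = begin
  1ℚ - iterate (offspringPGF p) 0ℚ (suc m)
    ≡⟨ cong (_-_ 1ℚ) (sym (iterate-is-fold 0ℚ (offspringPGF p) (suc m))) ⟩
  1ℚ - offspringPGF p (fold 0ℚ (offspringPGF p) m)
    ≡⟨ cong (λ u → 1ℚ - offspringPGF p u) (iterate-is-fold 0ℚ (offspringPGF p) m) ⟩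
  1ℚ - offspringPGF p u
    ≡⟨ solve 2 (λ p u → con 1ℚ :- ((con 1ℚ :- p) :+ p :* (u :* u))
                      := p :* ((con 1ℚ :- u) :* (con (fromℕ 2) :- (con 1ℚ :- u)))) refl p u ⟩
  p * (survival p m * (fromℕ 2 - survival p m)) ∎
  where
  open ≡-Reasoning
  u = iterate (offspringPGF p) 0ℚ m

survival-bounds : ∀ {p} → 0ℚ ≤ p → p ≤ 1ℚ → ∀ m → 0ℚ ≤ survival p m × survival p m ≤ 1ℚ
survival-bounds 0≤p p≤1 zero = ≤ᵇ⇒≤ _ , ≤-refl
survival-bounds {p} 0≤p p≤1 (suc m) =
  subst (λ x → 0ℚ ≤ x × x ≤ 1ℚ) (sym (survival-suc p m)) (0≤p[q[2-q]] , p[q[2-q]]≤1)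
  where
  q = survival p m
  0≤q : 0ℚ ≤ q
  0≤q = proj₁ (survival-bounds 0≤p p≤1 m)
  0≤2-q : 0ℚ ≤ fromℕ 2 - q
  0≤2-q = 0≤-difference (≤-trans (proj₂ (survival-bounds 0≤p p≤1 m)) 1≤2)
  0≤p[q[2-q]] : 0ℚ ≤ p * (q * (fromℕ 2 - q))
  0≤p[q[2-q]] = *-nonNeg 0≤p (*-nonNeg 0≤q 0≤2-q)
  p[q[2-q]]≤1 : p * (q * (fromℕ 2 - q)) ≤ 1ℚ
  p[q[2-q]]≤1 = ≤-by-difference ((1ℚ - p) + p * ((1ℚ - q) * (1ℚ - q)))
    (solve 2 (λ p q → con 1ℚ :- p :* (q :* (con (fromℕ 2) :- q))
                   := (con 1ℚ :- p) :+ p :* ((con 1ℚ :- q) :* (con 1ℚ :- q))) refl p q)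
    (+-nonNeg (0≤-difference p≤1) (*-nonNeg 0≤p (square-nonNeg (1ℚ - q))))

survival-geometric : ∀ {p} → 0ℚ ≤ p → ∀ m → survival p (suc m) ≤ (p + p) * survival p m
survival-geometric {p} 0≤p m = subst (_≤ (p + p) * q) (sym (survival-suc p m))
  (≤-by-difference (p * (q * q))
    (solve 2 (λ p q → (p :+ p) :* q :- p :* (q :* (con (fromℕ 2) :- q)) := p :* (q :* q)) refl p q)
    (*-nonNeg 0≤p (square-nonNeg q)))
  where q = survival p m

-- With y = 2 - Kx ≥ 0:  K²·(4 - (K + 1)·x(2 - x)) = 4 + 2(K + 1)(K - 2)·y + (K + 1)·y².
harmonic-bound-step : ∀ {K x} → fromℕ 2 ≤ K → K * x ≤ fromℕ 2 →
                      (K + 1ℚ) * (x * (fromℕ 2 - x)) ≤ fromℕ 4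
harmonic-bound-step {K} {x} 2≤K Kx≤2 =
  ≤-by-difference Z refl (nonNeg-cancelˡ 0<K (nonNeg-cancelˡ 0<K 0≤KKZ))
  where
  y = fromℕ 2 - K * x
  Z = fromℕ 4 - (K + 1ℚ) * (x * (fromℕ 2 - x))
  0<K : 0ℚ < K
  0<K = <-≤-trans (positive⁻¹ (fromℕ 2)) 2≤K
  0≤K+1 : 0ℚ ≤ K + 1ℚ
  0≤K+1 = +-nonNeg (<⇒≤ 0<K) (≤ᵇ⇒≤ _)
  0≤KKZ : 0ℚ ≤ K * (K * Z)
  0≤KKZ = subst (0ℚ ≤_)
    (solve 2 (λ K x → let two = con (fromℕ 2); y = two :- K :* x in
                 con (fromℕ 4) :+ two :* (K :+ con 1ℚ) :* (K :- two) :* y :+ (K :+ con 1ℚ) :* (y :* y)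
              := K :* (K :* (con (fromℕ 4) :- (K :+ con 1ℚ) :* (x :* (two :- x))))) refl K x)
    (+-nonNeg (+-nonNeg (fromℕ-nonNeg 4) (*-nonNeg (*-nonNeg 0≤2[K+1] (0≤-difference 2≤K)) (0≤-difference Kx≤2)))
              (*-nonNeg 0≤K+1 (square-nonNeg y)))
    where 0≤2[K+1] = *-nonNeg (fromℕ-nonNeg 2) 0≤K+1

survival-harmonic : ∀ {p} → 0ℚ ≤ p → p ≤ ½ → ∀ m → (fromℕ m + fromℕ 2) * survival p m ≤ fromℕ 2
survival-harmonic 0≤p p≤½ zero    = ≤-refl
survival-harmonic {p} 0≤p p≤½ (suc m) = begin
  (fromℕ (suc m) + fromℕ 2) * survival p (suc m)
    ≡⟨ cong₂ _*_ (cong (_+ fromℕ 2) (fromℕ-+ 1 m)) (survival-suc p m) ⟩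
  (1ℚ + fromℕ m + fromℕ 2) * (p * g)
    ≡⟨ solve 3 (λ k p g → (con 1ℚ :+ k :+ con (fromℕ 2)) :* (p :* g)
                       := p :* ((k :+ con (fromℕ 2) :+ con 1ℚ) :* g)) refl (fromℕ m) p g ⟩
  p * ((K + 1ℚ) * g)
    ≤⟨ *-monoʳ-≤-nonNeg ((K + 1ℚ) * g) {{nonNegative 0≤[K+1]g}} p≤½ ⟩
  ½ * ((K + 1ℚ) * g)
    ≤⟨ *-monoˡ-≤-nonNeg ½ (harmonic-bound-step 2≤K (survival-harmonic 0≤p p≤½ m)) ⟩
  ½ * fromℕ 4
    ≡⟨⟩
  fromℕ 2 ∎
  where
  open ≤-Reasoning
  K = fromℕ m + fromℕ 2
  q = survival p m
  g = q * (fromℕ 2 - q)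
  2≤K : fromℕ 2 ≤ K
  2≤K = subst (fromℕ 2 ≤_) (fromℕ-+ m 2) (fromℕ-mono-≤ (ℕ.m≤n+m 2 m))
  0≤[K+1]g : 0ℚ ≤ (K + 1ℚ) * g
  0≤[K+1]g = *-nonNeg (+-nonNeg (≤-trans (fromℕ-nonNeg 2) 2≤K) (≤ᵇ⇒≤ _))
                      (*-nonNeg (proj₁ bounds) (0≤-difference (≤-trans (proj₂ bounds) 1≤2)))
    where bounds = survival-bounds 0≤p (≤-trans p≤½ ½≤1) m

ETtrunc-upperBound : ∀ {p C} → 0ℚ ≤ p → p ≤ ½ → 0ℚ ≤ C → C * (p + p) + 1ℚ ≤ C →
                ∀ L n → ETtrunc p n ≤ fromℕ L + C * survival p L
ETtrunc-upperBound {p} {C} 0≤p p≤½ 0≤C C[p+p]+1≤C L n = begin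
  ETtrunc p n                                    ≡⟨ ETtrunc≡∑survival p n ⟩
  ∑ (suc n) q                                    ≤⟨ ∑-mono-≤-length (ℕ.m≤n+m (suc n) L) 0≤q ⟩
  ∑ (L ℕ.+ suc n) q                              ≡⟨ ∑-+ L (suc n) q ⟩
  ∑ L q + ∑ (suc n) (λ i → q (L ℕ.+ i))          ≤⟨ +-mono-≤ head tail ⟩
  fromℕ L + C * q L                              ∎
  where
  open ≤-Reasoning
  q = survival p
  0≤q : ∀ i → 0ℚ ≤ q i
  0≤q i = proj₁ (survival-bounds 0≤p (≤-trans p≤½ ½≤1) i)
  head : ∑ L q ≤ fromℕ L
  head = subst (∑ L q ≤_) (trans (∑-const L 1ℚ) (*-identityʳ (fromℕ L)))
    (∑-mono-≤ L (λ i _ → proj₂ (survival-bounds 0≤p (≤-trans p≤½ ½≤1) i)))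
  tail : ∑ (suc n) (λ i → q (L ℕ.+ i)) ≤ C * q L
  tail = subst (λ k → ∑ (suc n) (λ i → q (L ℕ.+ i)) ≤ C * q k) (ℕ.+-identityʳ L)
    (∑-geometric-tail 0≤C C[p+p]+1≤C (λ i → q (L ℕ.+ i)) (λ i → 0≤q (L ℕ.+ i))
      (λ i → subst (λ k → q k ≤ (p + p) * q (L ℕ.+ i)) (sym (ℕ.+-suc L i))
                   (survival-geometric 0≤p (L ℕ.+ i)))
      (suc n))

EWtrunc-lowerBound : ∀ {p} → 0ℚ ≤ p → p + p ≤ 1ℚ → ∀ N → fromℕ N * (1ℚ - (p + p)) ≤ ½ →
                ½ * fromℕ (suc N) ≤ EWtrunc p N
EWtrunc-lowerBound {p} 0≤p p+p≤1 N N[1-2p]≤½ =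
  subst (½ * fromℕ (suc N) ≤_) (sym (EWtrunc≡∑mean p N))
        (½[n+1]≤∑-powers (+-nonNeg 0≤p 0≤p) p+p≤1 N N[1-2p]≤½)

module NearCritical (l : ℕ) where

  L : ℕ
  L = suc l

  a : ℚ
  a = fromℕ L

  0≤a : 0ℚ ≤ a
  0≤a = fromℕ-nonNeg L

  4L² : ℕ
  4L² = 4 ℕ.* (L ℕ.* L)

  -- ε = 1/(4L²) is chosen so that C = 2L² satisfies C·2p + 1 = C and L²·(1 - 2p) = ½.
  ε : ℚ
  ε = 1/ fromℕ 4L²

  p : ℚ
  p = ½ - ε

  ε*4a²≡1 : ε * (fromℕ 4 * (a * a)) ≡ 1ℚ
  ε*4a²≡1 = trans (cong (ε *_) (sym (trans (fromℕ-* 4 (L ℕ.* L)) (cong (fromℕ 4 *_) (fromℕ-* L L)))))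
                  (*-inverseˡ (fromℕ 4L²))

  0≤ε : 0ℚ ≤ ε
  0≤ε = <⇒≤ (positive⁻¹ ε)

  ε<δ : ∀ {δ} → 0ℚ < δ → ↧ₙ δ ℕ.< L → ε < δ
  ε<δ 0<δ ↧δ<L =
    1/fromℕ-< 0<δ 4L² (ℕ.<-≤-trans ↧δ<L (ℕ.≤-trans (ℕ.m≤m*n L L) (ℕ.m≤n*m (L ℕ.* L) 4)))

  ½-δ<p : ∀ {δ} → 0ℚ < δ → ↧ₙ δ ℕ.< L → ½ - δ < p
  ½-δ<p {δ} 0<δ ↧δ<L = <-by-difference (δ - ε)
    (solve 2 (λ d e → (con ½ :- e) :- (con ½ :- d) := d :- e) refl δ ε) (0<-difference (ε<δ 0<δ ↧δ<L))

  0<p : 0ℚ < p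
  0<p = 0<-difference (1/fromℕ-< (positive⁻¹ ½) 4L² (ℕ.≤-trans (ℕ.n≤1+n 3) (ℕ.*-monoʳ-≤ 4 (s≤s z≤n))))

  p<½ : p < ½
  p<½ = <-by-difference ε (solve 1 (λ e → con ½ :- (con ½ :- e) := e) refl ε) (positive⁻¹ ε)

  0≤p : 0ℚ ≤ p
  0≤p = <⇒≤ 0<p

  p≤½ : p ≤ ½
  p≤½ = <⇒≤ p<½

  ETtrunc≤5a : ∀ n → ETtrunc p n ≤ fromℕ 5 * a
  ETtrunc≤5a n = ≤-trans (ETtrunc-upperBound 0≤p p≤½ 0≤C C[p+p]+1≤C L n) a+Cq≤5a
    where
    C = fromℕ 2 * (a * a)
    q = survival p L
    0≤C : 0ℚ ≤ C
    0≤C = *-nonNeg (fromℕ-nonNeg 2) (square-nonNeg a)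
    C[p+p]+1≤C : C * (p + p) + 1ℚ ≤ C
    C[p+p]+1≤C = ≤-reflexive (begin
      C * (p + p) + 1ℚ
        ≡⟨ solve 2 (λ a e → let C = con (fromℕ 2) :* (a :* a) in
                              C :* ((con ½ :- e) :+ (con ½ :- e)) :+ con 1ℚ
                           := C :+ (con 1ℚ :- e :* (con (fromℕ 4) :* (a :* a)))) refl a ε ⟩
      C + (1ℚ - ε * (fromℕ 4 * (a * a)))
        ≡⟨ cong (λ x → C + (1ℚ - x)) ε*4a²≡1 ⟩
      C + (1ℚ - 1ℚ)
        ≡⟨ +-identityʳ C ⟩
      C ∎)
      where open ≡-Reasoning
    a+Cq≤5a : a + C * q ≤ fromℕ 5 * a
    a+Cq≤5a = ≤-by-difference (fromℕ 2 * a * (fromℕ 2 - (a + fromℕ 2) * q) + fromℕ 4 * a * q)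
      (solve 2 (λ a q → let two = con (fromℕ 2) in
                          con (fromℕ 5) :* a :- (a :+ two :* (a :* a) :* q)
                       := two :* a :* (two :- (a :+ two) :* q) :+ con (fromℕ 4) :* a :* q) refl a q)
      (+-nonNeg (*-nonNeg (*-nonNeg (fromℕ-nonNeg 2) 0≤a) (0≤-difference (survival-harmonic 0≤p p≤½ L)))
                (*-nonNeg (*-nonNeg (fromℕ-nonNeg 4) 0≤a) (proj₁ (survival-bounds 0≤p (≤-trans p≤½ ½≤1) L))))

  ½[1+a²]≤EWtrunc : ½ * (1ℚ + a * a) ≤ EWtrunc p (L ℕ.* L)
  ½[1+a²]≤EWtrunc =
    subst (_≤ EWtrunc p (L ℕ.* L)) (cong (½ *_) (trans (fromℕ-+ 1 (L ℕ.* L)) (cong (1ℚ +_) (fromℕ-* L L))))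
          (EWtrunc-lowerBound 0≤p p+p≤1 (L ℕ.* L) (≤-reflexive L²[1-2p]≡½))
    where
    open ≡-Reasoning
    p+p≤1 : p + p ≤ 1ℚ
    p+p≤1 = ≤-by-difference (ε + ε) (solve 1 (λ e → con 1ℚ :- ((con ½ :- e) :+ (con ½ :- e)) := e :+ e) refl ε)
      (+-nonNeg 0≤ε 0≤ε)
    L²[1-2p]≡½ : fromℕ (L ℕ.* L) * (1ℚ - (p + p)) ≡ ½
    L²[1-2p]≡½ = begin
      fromℕ (L ℕ.* L) * (1ℚ - (p + p))
        ≡⟨ cong (_* (1ℚ - (p + p))) (fromℕ-* L L) ⟩
      a * a * (1ℚ - (p + p))
        ≡⟨ solve 2 (λ a e → a :* a :* (con 1ℚ :- ((con ½ :- e) :+ (con ½ :- e)))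
                         := con ½ :* (e :* (con (fromℕ 4) :* (a :* a)))) refl a ε ⟩
      ½ * (ε * (fromℕ 4 * (a * a)))
        ≡⟨ cong (½ *_) ε*4a²≡1 ⟩
      ½ ∎

  M*5a<EWtrunc : ∀ M → fromℕ 10 * fromℕ ℤ.∣ ↥ M ∣ ≤ a → M * (fromℕ 5 * a) < EWtrunc p (L ℕ.* L)
  M*5a<EWtrunc M 10∣M∣≤a = begin-strict
    M * (fromℕ 5 * a)
      ≤⟨ *-monoʳ-≤-nonNeg (fromℕ 5 * a) {{nonNegative (*-nonNeg (fromℕ-nonNeg 5) 0≤a)}} (p≤∣↥p∣ M) ⟩
    fromℕ ∣M∣ * (fromℕ 5 * a)
      ≤⟨ ≤-by-difference (½ * a * (a - fromℕ 10 * fromℕ ∣M∣))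
           (solve 2 (λ a x → con ½ :* (a :* a) :- x :* (con (fromℕ 5) :* a)
                          := con ½ :* a :* (a :- con (fromℕ 10) :* x)) refl a (fromℕ ∣M∣))
           (*-nonNeg (*-nonNeg 0≤½ 0≤a) (0≤-difference 10∣M∣≤a)) ⟩
    ½ * (a * a)
      <⟨ <-by-difference ½ (solve 1 (λ x → con ½ :* (con 1ℚ :+ x) :- con ½ :* x := con ½) refl (a * a))
                           (positive⁻¹ ½) ⟩
    ½ * (1ℚ + a * a)
      ≤⟨ ½[1+a²]≤EWtrunc ⟩
    EWtrunc p (L ℕ.* L) ∎
    where
    open ≤-Reasoning
    ∣M∣ = ℤ.∣ ↥ M ∣

proposition6 : (M : ℚ) → (δ : ℚ) → 0ℚ < δ →
    Σ ℚ λ p → (0ℚ < p) × (p < ½) × (½ - δ < p) ×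
      Σ ℚ λ B → ((n : ℕ) → ETtrunc p n ≤ B) ×
        Σ ℕ λ N → M * B < EWtrunc p N
proposition6 M δ 0<δ =
  p , 0<p , p<½ , ½-δ<p 0<δ ↧δ<L , fromℕ 5 * a , ETtrunc≤5a , L ℕ.* L , M*5a<EWtrunc M 10∣M∣≤a
  where
  ∣M∣ = ℤ.∣ ↥ M ∣
  open NearCritical (↧ₙ δ ℕ.+ 10 ℕ.* ∣M∣)
  ↧δ<L : ↧ₙ δ ℕ.< L
  ↧δ<L = s≤s (ℕ.m≤m+n (↧ₙ δ) (10 ℕ.* ∣M∣))
  10∣M∣≤a : fromℕ 10 * fromℕ ∣M∣ ≤ a
  10∣M∣≤a = subst (_≤ a) (fromℕ-* 10 ∣M∣) (fromℕ-mono-≤ (ℕ.m≤n+m (10 ℕ.* ∣M∣) (suc (↧ₙ δ))))
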